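{- Let $P$ be a lattice polytope whose $h^*$-polynomial is log-concave. Then the sequence $E_P(0),E_P(1),E_P(2),\ldots$ is log-concave, i.e. $E_P(m)^2\geq E_P(m-1)E_P(m+1)$ for all $m\geq1$.
   Context: For a lattice polytope $P\subseteq\mathbb{R}^n$ of dimension $d$, $E_P(m)=\#(mP\cap\mathbb{Z}^n)$ (with $E_P(0)=1$) and $h^*_P(x)$ is the unique polynomial of degree at most $d$ with $\sum_{m\geq0}E_P(m)x^m=h^*_P(x)/(1-x)^{d+1}$. A polynomial $\sum_{j=0}^s a_jx^j$ of degree $s$ is log-concave if all $a_j>0$ and $a_j^2\geq a_{j-1}a_{j+1}$ for $1\leq j\leq s-1$; a sequence of positive reals is log-concave if $a_j^2\geq a_{j-1}a_{j+1}$ for all interior indices. -}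

module Defs where

open import Data.Nat as ℕ using (ℕ; zero; suc)
open import Data.Nat.Combinatorics using (_C_)
open import Data.Integer as ℤ using (ℤ; +_)
open import Data.Rational as ℚ using (ℚ; 0ℚ)
open import Data.Fin using (Fin; zero; suc; toℕ)
open import Relation.Nullary using (¬_)
open import Data.List using (List; length)
open import Data.List.Relation.Unary.Unique.Propositional using (Unique)
open import Data.List.Membership.Propositional using (_∈_)
open import Data.Product using (Σ; ∃; _×_; _,_)
open import Function.Bundles using (_⇔_)
open import Relation.Binary.PropositionalEquality using (_≡_; _≢_)

Pt : ℕ → Set
Pt n = Fin n → ℤ

toℚ : ℤ → ℚ
toℚ z = z ℚ./ 1

sumℚ : ∀ {k} → (Fin k → ℚ) → ℚ
sumℚ {zero}  f = 0ℚ
sumℚ {suc k} f = f zero ℚ.+ sumℚ (λ i → f (suc i))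

sumℤ : ∀ {k} → (Fin k → ℤ) → ℤ
sumℤ {zero}  f = + 0
sumℤ {suc k} f = f zero ℤ.+ sumℤ (λ i → f (suc i))

-- A lattice polytope P = conv(V) with a nonempty finite list of lattice
-- points V : Fin (suc N) → ℤⁿ.
-- x ∈ m·P  iff  x = Σ λᵢ Vᵢ with λᵢ ∈ ℚ, λᵢ ≥ 0, Σ λᵢ = m.
InDilate : ∀ {n N} → (Fin (suc N) → Pt n) → ℕ → Pt n → Set
InDilate {n} {N} V m x =
  Σ (Fin (suc N) → ℚ) λ lam →
    (∀ i → 0ℚ ℚ.≤ lam i) ×
    (sumℚ lam ≡ toℚ (+ m)) ×
    (∀ c → sumℚ (λ i → lam i ℚ.* toℚ (V i c)) ≡ toℚ (x c))

-- E is the Ehrhart function: E m = #(mP ∩ ℤⁿ), witnessed by a duplicate-free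
-- list enumerating exactly the lattice points of mP.
IsEhrhart : ∀ {n N} → (Fin (suc N) → Pt n) → (ℕ → ℕ) → Set
IsEhrhart {n} V E = ∀ m → Σ (List (Pt n)) λ L →
  Unique L × (∀ x → (x ∈ L) ⇔ InDilate V m x) × (length L ≡ E m)

-- points w₀,…,w_k are affinely independent (over ℚ, equivalently over ℤ):
-- Σ cᵢ (w_{i+1} - w₀) = 0 with integer cᵢ forces all cᵢ = 0.
AffIndep : ∀ {n k} → (Fin (suc k) → Pt n) → Set
AffIndep {n} {k} w = (c : Fin k → ℤ) →
  (∀ t → sumℤ (λ i → c i ℤ.* (w (suc i) t ℤ.- w zero t)) ≡ + 0) →
  ∀ i → c i ≡ + 0

HasDim : ∀ {n N} → (Fin (suc N) → Pt n) → ℕ → Set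
HasDim {n} {N} V d =
  (Σ (Fin (suc d) → Fin (suc N)) λ s → AffIndep (λ i → V (s i))) ×
  ((s : Fin (suc (suc d)) → Fin (suc N)) → ¬ AffIndep (λ i → V (s i)))

sgn : ℕ → ℤ
sgn zero = + 1
sgn (suc i) = ℤ.- sgn i

-- coefficient of x^k in (1-x)^(d+1) · Σ_m E(m) x^m
coeffTimes : ℕ → (ℕ → ℕ) → ℕ → ℤ
coeffTimes d E k =
  sumℤ {suc k} (λ i → sgn (toℕ i) ℤ.* (+ ((suc d) C (toℕ i))) ℤ.* (+ E (k ℕ.∸ toℕ i)))

-- h is (the coefficient sequence of) h*_P: the polynomial of degree ≤ d with
-- Σ_m E(m) x^m = h(x)/(1-x)^(d+1), i.e. h(x) = (1-x)^(d+1) Σ_m E(m) x^m.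
IsHStar : ℕ → (ℕ → ℕ) → (ℕ → ℤ) → Set
IsHStar d E h = (∀ k → d ℕ.< k → h k ≡ + 0) × (∀ k → h k ≡ coeffTimes d E k)

HasDegree : (ℕ → ℤ) → ℕ → Set
HasDegree h s = (h s ≢ + 0) × (∀ k → s ℕ.< k → h k ≡ + 0)

LogConcavePoly : (ℕ → ℤ) → ℕ → Set
LogConcavePoly a s =
  (∀ j → j ℕ.≤ s → + 0 ℤ.< a j) ×
  (∀ j → suc j ℕ.< s → a j ℤ.* a (suc (suc j)) ℤ.≤ a (suc j) ℤ.* a (suc j))

-- The coefficients h₀,…,h_s of h* are positive and log-concave, so the ratios
-- h_{i+1}/h_i decrease; in
-- the multiplicative form h_{m+1} h_i ≤ h_m h_{i+1} (i ≤ m) this stays true when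
-- the sequence is extended by zeros. Since Σ E(m) xᵐ = h*(x)/(1-x)^(d+1) and
-- multiplying by 1/(1-x) takes partial sums, E is the (d+1)-fold iterated
-- partial sum of h. Partial sums of a sequence with decreasing ratios and
-- positive first term are positive and log-concave, hence again have
-- decreasing ratios; so after d+1 steps E is log-concave.
module Submission where

open import Defs
open import Data.Nat using (ℕ; suc; _*_; _≤_; _∸_)
open import Data.Integer using (ℤ)
open import Data.Fin using (Fin)

open import Data.Nat as ℕ using (zero; _+_; _<_; _≤′_; ≤′-refl; ≤′-step; z≤n; >-nonZero; _≤?_)
open import Data.Nat.Properties
  using (*-comm; ≤-reflexive; ≤-refl; ≤-trans; n≤1+n; m≤n⇒m≤1+n; m≤n+m; m≤m+n; ≤⇒≤′; ≰⇒>;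
         *-cancelʳ-≤; *-mono-≤; *-monoʳ-≤; +-mono-≤; m*n≢0; *-distribˡ-+; *-distribʳ-+;
         +-monoʳ-≤; module ≤-Reasoning)
open import Data.Nat.GeneralisedArithmetic using (iterate)
open import Data.Nat.Combinatorics using (_C_; nCk+nC[k+1]≡[n+1]C[k+1])
import Data.Nat.Tactic.RingSolver as ℕ-Ring
open import Data.Integer as ℤ using (+_; ∣_∣)
import Data.Integer.Properties as ℤ
import Data.Integer.Tactic.RingSolver as ℤ-Ring
open import Data.Fin as Fin using (toℕ)
open import Data.Product using (_×_; _,_; proj₁; proj₂)
open import Function using (_∘_)
open import Relation.Nullary using (yes; no)
open import Relation.Binary.PropositionalEquality

module _ {A : Set} (_∙_ : A → A → A) where

  partialSums : (ℕ → A) → ℕ → A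
  partialSums g zero    = g zero
  partialSums g (suc k) = partialSums g k ∙ g (suc k)

  partialSums-cong : ∀ {g g′} → g ≗ g′ → partialSums g ≗ partialSums g′
  partialSums-cong g≗g′ zero    = g≗g′ zero
  partialSums-cong g≗g′ (suc k) = cong₂ _∙_ (partialSums-cong g≗g′ k) (g≗g′ (suc k))

iterate-cong : ∀ {A : Set} {F : (ℕ → A) → ℕ → A} → (∀ {g g′} → g ≗ g′ → F g ≗ F g′) →
               ∀ e {g g′} → g ≗ g′ → iterate F g e ≗ iterate F g′ e
iterate-cong F-cong zero    g≗g′ = g≗g′
iterate-cong F-cong (suc e) g≗g′ = iterate-cong F-cong e (F-cong g≗g′)

module _ {A B : Set} {_∙_ : A → A → A} {_∗_ : B → B → B}
         (φ : A → B) (φ-homo : ∀ x y → φ (x ∙ y) ≡ φ x ∗ φ y) where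

  partialSums-map : ∀ g → φ ∘ partialSums _∙_ g ≗ partialSums _∗_ (φ ∘ g)
  partialSums-map g zero    = refl
  partialSums-map g (suc k) = trans (φ-homo _ _) (cong (_∗ φ (g (suc k))) (partialSums-map g k))

  iterate-partialSums-map : ∀ e g →
    φ ∘ iterate (partialSums _∙_) g e ≗ iterate (partialSums _∗_) (φ ∘ g) e
  iterate-partialSums-map zero    g k = refl
  iterate-partialSums-map (suc e) g k =
    trans (iterate-partialSums-map e (partialSums _∙_ g) k)
          (iterate-cong (partialSums-cong _∗_) e (partialSums-map g) k)

LogConcave : (ℕ → ℕ) → Set
LogConcave b = ∀ j → b j * b (suc (suc j)) ≤ b (suc j) * b (suc j)

PositiveLogConcaveUpTo : (ℕ → ℕ) → ℕ → Set
PositiveLogConcaveUpTo b M =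
  (∀ j → j ≤ M → 0 < b j) ×
  (∀ j → suc j < M → b j * b (suc (suc j)) ≤ b (suc j) * b (suc j))

-- b (i+1) / b i ≥ b (m+1) / b m, cleared of denominators so that zeros are allowed.
DecreasingRatios : (ℕ → ℕ) → Set
DecreasingRatios b = ∀ {i m} → i ≤ m → b (suc m) * b i ≤ b m * b (suc i)

decreasingRatios⇒logConcave : ∀ {b} → DecreasingRatios b → LogConcave b
decreasingRatios⇒logConcave {b} ratios j =
  subst (_≤ b (suc j) * b (suc j)) (*-comm (b (suc (suc j))) (b j)) (ratios (n≤1+n j))

module _ {b : ℕ → ℕ} {M : ℕ} (lc : PositiveLogConcaveUpTo b M) where

  private
    ratios′ : ∀ {i m} → i ≤′ m → suc m ≤ M → b (suc m) * b i ≤ b m * b (suc i)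
    ratios′ {i} ≤′-refl _ = ≤-reflexive (*-comm (b (suc i)) (b i))
    ratios′ {i} (≤′-step {m} i≤′m) 2+m≤M =
      *-cancelʳ-≤ (b (2 + m) * b i) (b (1 + m) * b (1 + i)) (b m * b (1 + m))
                  {{m*n≢0 _ _ {{>-nonZero (pos m (n≤1+n m))}} {{>-nonZero (pos (1 + m) ≤-refl)}}}} (begin
        b (2 + m) * b i * (b m * b (1 + m))              ≡⟨ regroup (b (2 + m)) (b i) (b m) (b (1 + m)) ⟩
        (b m * b (2 + m)) * (b (1 + m) * b i)            ≤⟨ *-mono-≤ (proj₂ lc m 2+m≤M) (ratios′ i≤′m 1+m≤M) ⟩
        (b (1 + m) * b (1 + m)) * (b m * b (1 + i))      ≡⟨ regroup′ (b (1 + m)) (b m) (b (1 + i)) ⟩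
        b (1 + m) * b (1 + i) * (b m * b (1 + m))        ∎)
      where
      open ≤-Reasoning
      1+m≤M : suc m ≤ M
      1+m≤M = ≤-trans (n≤1+n (suc m)) 2+m≤M
      pos : ∀ j → j ≤ suc m → 0 < b j
      pos j j≤1+m = proj₁ lc j (≤-trans j≤1+m 1+m≤M)
      regroup : ∀ x y z w → x * y * (z * w) ≡ (z * x) * (w * y)
      regroup = ℕ-Ring.solve-∀
      regroup′ : ∀ x z y → (x * x) * (z * y) ≡ x * y * (z * x)
      regroup′ = ℕ-Ring.solve-∀

  positiveLogConcaveUpTo⇒ratios : ∀ {i m} → i ≤ m → suc m ≤ M → b (suc m) * b i ≤ b m * b (suc i)
  positiveLogConcaveUpTo⇒ratios i≤m = ratios′ (≤⇒≤′ i≤m)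

positiveLogConcaveUpTo⇒decreasingRatios : ∀ {b s} → PositiveLogConcaveUpTo b s →
  (∀ k → s < k → b k ≡ 0) → DecreasingRatios b
positiveLogConcaveUpTo⇒decreasingRatios {s = s} lc vanish {m = m} i≤m with suc m ≤? s
... | yes 1+m≤s = positiveLogConcaveUpTo⇒ratios lc i≤m 1+m≤s
... | no  1+m≰s rewrite vanish (suc m) (≰⇒> 1+m≰s) = z≤n

positive-logConcave⇒decreasingRatios : ∀ {b} → (∀ j → 0 < b j) → LogConcave b → DecreasingRatios b
positive-logConcave⇒decreasingRatios pos lc i≤m =
  positiveLogConcaveUpTo⇒ratios ((λ j _ → pos j) , (λ j _ → lc j)) i≤m ≤-refl

module _ {g : ℕ → ℕ} (ratios : DecreasingRatios g) where

  private
    S = partialSums _+_ g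

  partialSums-ratio : ∀ {k m} → k ≤ m → g (2 + m) * S k ≤ g (1 + m) * S (1 + k)
  partialSums-ratio {zero}  {m} _ =
    ≤-trans (ratios {m = suc m} z≤n) (*-monoʳ-≤ (g (1 + m)) (m≤n+m (g 1) (g 0)))
  partialSums-ratio {suc k} {m} 1+k≤m = begin
    g (2 + m) * (S k + g (1 + k))                  ≡⟨ *-distribˡ-+ (g (2 + m)) (S k) (g (1 + k)) ⟩
    g (2 + m) * S k + g (2 + m) * g (1 + k)        ≤⟨ +-mono-≤ (partialSums-ratio (≤-trans (n≤1+n k) 1+k≤m))
                                                               (ratios (m≤n⇒m≤1+n 1+k≤m)) ⟩
    g (1 + m) * S (1 + k) + g (1 + m) * g (2 + k)  ≡⟨ *-distribˡ-+ (g (1 + m)) (S (1 + k)) (g (2 + k)) ⟨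
    g (1 + m) * S (2 + k)                          ∎
    where open ≤-Reasoning

  partialSums-logConcave : LogConcave S
  partialSums-logConcave m = begin
    S m * (S (1 + m) + g (2 + m))                  ≡⟨ *-distribˡ-+ (S m) (S (1 + m)) (g (2 + m)) ⟩
    S m * S (1 + m) + S m * g (2 + m)              ≡⟨ cong (_+_ (S m * S (1 + m))) (*-comm (S m) (g (2 + m))) ⟩
    S m * S (1 + m) + g (2 + m) * S m              ≤⟨ +-monoʳ-≤ (S m * S (1 + m)) (partialSums-ratio ≤-refl) ⟩
    S m * S (1 + m) + g (1 + m) * S (1 + m)        ≡⟨ *-distribʳ-+ (S (1 + m)) (S m) (g (1 + m)) ⟨
    S (1 + m) * S (1 + m)                          ∎
    where open ≤-Reasoning

partialSums-positive : ∀ {g} → 0 < g 0 → ∀ k → 0 < partialSums _+_ g k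
partialSums-positive g₀>0 zero    = g₀>0
partialSums-positive {g} g₀>0 (suc k) =
  ≤-trans (partialSums-positive g₀>0 k) (m≤m+n (partialSums _+_ g k) (g (suc k)))

iterate-partialSums-decreasingRatios : ∀ e {g} → 0 < g 0 → DecreasingRatios g →
  DecreasingRatios (iterate (partialSums _+_) g e)
iterate-partialSums-decreasingRatios zero    _    ratios = ratios
iterate-partialSums-decreasingRatios (suc e) g₀>0 ratios =
  iterate-partialSums-decreasingRatios e g₀>0
    (positive-logConcave⇒decreasingRatios (partialSums-positive g₀>0) (partialSums-logConcave ratios))

sumℤ-cong : ∀ {k} {f g : Fin k → ℤ} → (∀ i → f i ≡ g i) → sumℤ f ≡ sumℤ g
sumℤ-cong {zero}  f≗g = refl
sumℤ-cong {suc k} f≗g = cong₂ ℤ._+_ (f≗g Fin.zero) (sumℤ-cong (f≗g ∘ Fin.suc))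

sumℤ-zero : ∀ {k} {f : Fin k → ℤ} → (∀ i → f i ≡ + 0) → sumℤ f ≡ + 0
sumℤ-zero {zero}  f≡0 = refl
sumℤ-zero {suc k} f≡0 = cong₂ ℤ._+_ (f≡0 Fin.zero) (sumℤ-zero (f≡0 ∘ Fin.suc))

sumℤ-sub : ∀ {k} (f g : Fin k → ℤ) → sumℤ (λ i → f i ℤ.- g i) ≡ sumℤ f ℤ.- sumℤ g
sumℤ-sub {zero}  f g = refl
sumℤ-sub {suc k} f g =
  trans (cong (ℤ._+_ (f Fin.zero ℤ.- g Fin.zero)) (sumℤ-sub (f ∘ Fin.suc) (g ∘ Fin.suc)))
        (interchange (f Fin.zero) (g Fin.zero) (sumℤ (f ∘ Fin.suc)) (sumℤ (g ∘ Fin.suc)))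
  where
  interchange : ∀ a b c d → (a ℤ.- b) ℤ.+ (c ℤ.- d) ≡ (a ℤ.+ c) ℤ.- (b ℤ.+ d)
  interchange = ℤ-Ring.solve-∀

-- The coefficient of xᵏ in (1 - x)ᵉ Σₘ f(m) xᵐ, i.e. the e-th backward difference
-- of f (extended by 0 to negative indices); coeffTimes d E is
-- backwardDiff (suc d) (+_ ∘ E) by definition.
backwardDiff : ℕ → (ℕ → ℤ) → ℕ → ℤ
backwardDiff e f k = sumℤ {suc k} (λ i → sgn (toℕ i) ℤ.* + (e C toℕ i) ℤ.* f (k ∸ toℕ i))

backwardDiff-zero : ∀ f → backwardDiff 0 f ≗ f
backwardDiff-zero f k =
  trans (cong (ℤ._+_ (+ 1 ℤ.* + 1 ℤ.* f k)) (sumℤ-zero {k} λ i → cong (ℤ._* f (k ∸ suc (toℕ i))) (ℤ.*-zeroʳ (sgn (suc (toℕ i))))))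
        (unit (f k))
  where
  unit : ∀ x → + 1 ℤ.* + 1 ℤ.* x ℤ.+ + 0 ≡ x
  unit = ℤ-Ring.solve-∀

backwardDiff-suc : ∀ e f k →
  backwardDiff (suc e) f (suc k) ≡ backwardDiff e f (suc k) ℤ.- backwardDiff e f k
backwardDiff-suc e f k = begin
  head ℤ.+ sumℤ {suc k} (λ i → sgn (suc (toℕ i)) ℤ.* + (suc e C suc (toℕ i)) ℤ.* f (k ∸ toℕ i))
    ≡⟨ cong (ℤ._+_ head) (sumℤ-cong {suc k} (λ i → pascal (toℕ i) (f (k ∸ toℕ i)))) ⟩
  head ℤ.+ sumℤ (λ i → upper i ℤ.- lower i)
    ≡⟨ cong (ℤ._+_ head) (sumℤ-sub upper lower) ⟩
  head ℤ.+ (sumℤ upper ℤ.- sumℤ lower)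
    ≡⟨ ℤ.+-assoc head (sumℤ upper) (ℤ.- sumℤ lower) ⟨
  head ℤ.+ sumℤ upper ℤ.- sumℤ lower
    ∎
  where
  open ≡-Reasoning
  head = sgn 0 ℤ.* + 1 ℤ.* f (suc k)
  upper lower : Fin (suc k) → ℤ
  upper i = sgn (suc (toℕ i)) ℤ.* + (e C suc (toℕ i)) ℤ.* f (k ∸ toℕ i)
  lower i = sgn (toℕ i) ℤ.* + (e C toℕ i) ℤ.* f (k ∸ toℕ i)
  distrib : ∀ s p q x → ℤ.- s ℤ.* (p ℤ.+ q) ℤ.* x ≡ ℤ.- s ℤ.* q ℤ.* x ℤ.- s ℤ.* p ℤ.* x
  distrib = ℤ-Ring.solve-∀
  pascal : ∀ j x → sgn (suc j) ℤ.* + (suc e C suc j) ℤ.* x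
                 ≡ sgn (suc j) ℤ.* + (e C suc j) ℤ.* x ℤ.- sgn j ℤ.* + (e C j) ℤ.* x
  pascal j x = begin
    ℤ.- sgn j ℤ.* + (suc e C suc j) ℤ.* x
      ≡⟨ cong (λ c → ℤ.- sgn j ℤ.* + c ℤ.* x) (nCk+nC[k+1]≡[n+1]C[k+1] e j) ⟨
    ℤ.- sgn j ℤ.* + (e C j ℕ.+ e C suc j) ℤ.* x
      ≡⟨ cong (λ c → ℤ.- sgn j ℤ.* c ℤ.* x) (ℤ.pos-+ (e C j) (e C suc j)) ⟩
    ℤ.- sgn j ℤ.* (+ (e C j) ℤ.+ + (e C suc j)) ℤ.* x
      ≡⟨ distrib (sgn j) (+ (e C j)) (+ (e C suc j)) x ⟩
    ℤ.- sgn j ℤ.* + (e C suc j) ℤ.* x ℤ.- sgn j ℤ.* + (e C j) ℤ.* x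
      ∎

partialSums-backwardDiff : ∀ e f → partialSums ℤ._+_ (backwardDiff (suc e) f) ≗ backwardDiff e f
partialSums-backwardDiff e f zero    = refl
partialSums-backwardDiff e f (suc k)
  rewrite partialSums-backwardDiff e f k | backwardDiff-suc e f k =
  telescope (backwardDiff e f k) (backwardDiff e f (suc k))
  where
  telescope : ∀ a b → a ℤ.+ (b ℤ.- a) ≡ b
  telescope = ℤ-Ring.solve-∀

iterate-partialSums-backwardDiff : ∀ e f → iterate (partialSums ℤ._+_) (backwardDiff e f) e ≗ f
iterate-partialSums-backwardDiff zero    f = backwardDiff-zero f
iterate-partialSums-backwardDiff (suc e) f k =
  trans (iterate-cong (partialSums-cong ℤ._+_) e (partialSums-backwardDiff e f) k)
        (iterate-partialSums-backwardDiff e f k)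

iterate-partialSums-hStar : ∀ {d E h} → IsHStar d E h → (∀ k → + ∣ h k ∣ ≡ h k) →
  iterate (partialSums _+_) (∣_∣ ∘ h) (suc d) ≗ E
iterate-partialSums-hStar {d} {E} {h} (_ , h≡coeff) nonNeg k = ℤ.+-injective (begin
  + iterate (partialSums _+_) (∣_∣ ∘ h) (suc d) k
    ≡⟨ iterate-partialSums-map +_ ℤ.pos-+ (suc d) (∣_∣ ∘ h) k ⟩
  iterate (partialSums ℤ._+_) (+_ ∘ ∣_∣ ∘ h) (suc d) k
    ≡⟨ iterate-cong (partialSums-cong ℤ._+_) (suc d) (λ j → trans (nonNeg j) (h≡coeff j)) k ⟩
  iterate (partialSums ℤ._+_) (backwardDiff (suc d) (+_ ∘ E)) (suc d) k
    ≡⟨ iterate-partialSums-backwardDiff (suc d) (+_ ∘ E) k ⟩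
  + E k
    ∎)
  where open ≡-Reasoning

module _ {h : ℕ → ℤ} {s : ℕ} (vanish : ∀ k → s < k → h k ≡ + 0) (lc : LogConcavePoly h s) where

  logConcavePoly-nonNegative : ∀ k → + ∣ h k ∣ ≡ h k
  logConcavePoly-nonNegative k with k ≤? s
  ... | yes k≤s = ℤ.0≤i⇒+∣i∣≡i (ℤ.<⇒≤ (proj₁ lc k k≤s))
  ... | no  k≰s rewrite vanish k (≰⇒> k≰s) = refl

  logConcavePoly-∣∣ : PositiveLogConcaveUpTo (∣_∣ ∘ h) s
  logConcavePoly-∣∣ =
    (λ j j≤s → ℤ.drop‿+<+ (subst (+ 0 ℤ.<_) (sym (logConcavePoly-nonNegative j)) (proj₁ lc j j≤s))) ,
    (λ j 1+j<s → ℤ.drop‿+≤+ (subst₂ ℤ._≤_ (product j (2 + j)) (product (1 + j) (1 + j)) (proj₂ lc j 1+j<s)))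
    where
    product : ∀ x y → h x ℤ.* h y ≡ + (∣ h x ∣ * ∣ h y ∣)
    product x y = begin
      h x ℤ.* h y                   ≡⟨ cong₂ ℤ._*_ (logConcavePoly-nonNegative x) (logConcavePoly-nonNegative y) ⟨
      + ∣ h x ∣ ℤ.* + ∣ h y ∣       ≡⟨ ℤ.pos-* ∣ h x ∣ ∣ h y ∣ ⟨
      + (∣ h x ∣ * ∣ h y ∣)         ∎
      where open ≡-Reasoning

mainTheorem8 : (n N : ℕ) (V : Fin (suc N) → Pt n) (d : ℕ) → HasDim V d →
    (E : ℕ → ℕ) → IsEhrhart V E →
    (h : ℕ → ℤ) → IsHStar d E h →
    (s : ℕ) → HasDegree h s → LogConcavePoly h s →
    ∀ m → 1 ≤ m → E (m ∸ 1) * E (suc m) ≤ E m * E m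
mainTheorem8 _ _ _ d _ E _ h hStar s (_ , vanish) lc (suc m) _ =
  subst₂ _≤_ (cong₂ _*_ (b≗E m) (b≗E (2 + m))) (cong₂ _*_ (b≗E (1 + m)) (b≗E (1 + m)))
         (decreasingRatios⇒logConcave {b} b-ratios m)
  where
  a : ℕ → ℕ
  a = ∣_∣ ∘ h
  a-positiveLogConcave : PositiveLogConcaveUpTo a s
  a-positiveLogConcave = logConcavePoly-∣∣ vanish lc
  a-ratios : DecreasingRatios a
  a-ratios = positiveLogConcaveUpTo⇒decreasingRatios a-positiveLogConcave (λ k s<k → cong ∣_∣ (vanish k s<k))
  b : ℕ → ℕ
  b = iterate (partialSums _+_) a (suc d)
  b-ratios : DecreasingRatios b
  b-ratios = iterate-partialSums-decreasingRatios (suc d) (proj₁ a-positiveLogConcave 0 z≤n) a-ratios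
  b≗E : b ≗ E
  b≗E = iterate-partialSums-hStar hStar (logConcavePoly-nonNegative vanish lc)
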